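{- Let $d$ be a positive integer. For integers $0\le k\le n$, $$\frac{\det\left(\binom{n+i+j}{k+j}_{F(s,t)}\right)_{i,j=0}^{d-1}}{\det\left(\binom{n+i+j}{j}_{F(s,t)}\right)_{i,j=0}^{d-1}}=\left\langle \begin{matrix} n\\ k\end{matrix}\right\rangle_{d,F(s,t)},$$ and for integers $n,k\ge0$, $$\frac{\det\left(\binom{n+i+k}{k+j}_{F(s,t)}\right)_{i,j=0}^{d-1}}{\det\left(\binom{n+i}{j}_{F(s,t)}\right)_{i,j=0}^{d-1}}=\left\langle \begin{matrix} n+k\\ k\end{matrix}\right\rangle_{d,F(s,t)},$$ as identities of rational functions in $s,t$.
   Context: $s,t$ are indeterminates. Fibonacci polynomials: $F_0(s,t)=0$, $F_1(s,t)=1$, $F_n(s,t)=sF_{n-1}(s,t)+tF_{n-2}(s,t)$. Fibonomials: $\binom{m}{k}_{F(s,t)}=\prod_{j=0}^{k-1}\frac{F_{m-j}(s,t)}{F_{k-j}(s,t)}$ for $0\le k\le m$, and $0$ if $k<0$ or $k>m$. Hoggatt coefficients: for $0\le k\le n$, $\left\langle \begin{matrix} n\\ k\end{matrix}\right\rangle_{d,F(s,t)}=\prod_{j=0}^{k-1}\frac{\binom{n-j+d-1}{d}_{F(s,t)}}{\binom{k-j+d-1}{d}_{F(s,t)}}$. -}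

module Defs where

open import Level using (Level; _⊔_)
open import Data.Nat as ℕ using (ℕ; zero; suc; _∸_; _≤?_)
open import Data.Fin using (Fin; zero; suc; toℕ; punchIn)
open import Relation.Nullary using (¬_; yes; no)
open import Algebra.Bundles using (CommutativeRing)

-- A field, presented (as usual in formal libraries) as a commutative ring
-- with a total inverse function that is a genuine inverse on nonzero elements.
record Field (c ℓ : Level) : Set (Level.suc (c ⊔ ℓ)) where
  field
    commutativeRing : CommutativeRing c ℓ
  open CommutativeRing commutativeRing public
  field
    _⁻¹      : Carrier → Carrier
    0≉1      : ¬ (0# ≈ 1#)
    inverseʳ : ∀ x → ¬ (x ≈ 0#) → x * (x ⁻¹) ≈ 1#

module FieldDefs {c ℓ : Level} (K : Field c ℓ) where
  open Field K using (Carrier; _≈_; 0#; 1#; _+_; _*_; -_; _⁻¹)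

  sumFin : (n : ℕ) → (Fin n → Carrier) → Carrier
  sumFin zero    f = 0#
  sumFin (suc n) f = f zero + sumFin n (λ i → f (suc i))

  prod : ℕ → (ℕ → Carrier) → Carrier
  prod zero    f = 1#
  prod (suc k) f = prod k f * f k

  sign : ℕ → Carrier
  sign zero    = 1#
  sign (suc j) = - sign j

  det : (n : ℕ) → (Fin n → Fin n → Carrier) → Carrier
  det zero    M = 1#
  det (suc n) M =
    sumFin (suc n) (λ j → sign (toℕ j) * (M zero j * det n (λ i k → M (suc i) (punchIn j k))))

  F : Carrier → Carrier → ℕ → Carrier
  F s t zero          = 0#
  F s t (suc zero)    = 1#
  F s t (suc (suc n)) = s * F s t (suc n) + t * F s t n

  fibonomial : Carrier → Carrier → ℕ → ℕ → Carrier
  fibonomial s t m k with k ≤? m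
  ... | yes _ = prod k (λ j → F s t (m ∸ j) * (F s t (k ∸ j) ⁻¹))
  ... | no  _ = 0#

  hoggatt : Carrier → Carrier → ℕ → ℕ → ℕ → Carrier
  hoggatt s t d n k =
    prod k (λ j → fibonomial s t ((n ∸ j) ℕ.+ d ∸ 1) d
                  * (fibonomial s t ((k ∸ j) ℕ.+ d ∸ 1) d ⁻¹))

-- Write [m]! = F₁ F₂ ⋯ Fₘ. On its support the fibonomial is [m]! / ([m−k]! [k]!), and it
-- vanishes off it. In both identities, multiplying row i and column j of the two matrices by
-- suitable Fibonacci factorials turns them into one and the same matrix (with entries
-- [n+i+j]! in the first identity and [n+i]! [n+i+k]! / [n+i−j]! in the second, zeros
-- included). As det scales with its rows and columns, the quotient of the determinants is a
-- quotient Φ(n) Φ(0) / (Φ(n−k) Φ(k)) of the products Φ(m) = [m]! [m+1]! ⋯ [m+d−1]!.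
-- Finally Φ(m+1) = [d]! · binom(m+d, d) · Φ(m), so the telescoping that evaluates a fibonomial
-- as a quotient of factorials evaluates the Hoggatt coefficient as this quotient of Φ's.
module Submission where

open import Defs
open import Level using (Level)
open import Data.Nat using (ℕ; zero; suc; _+_; _∸_; _≤_; _<_; s≤s; _≤?_)
open import Data.Nat.Properties
  using (≤-refl; ≤-trans; m≤n⇒m≤1+n; m≤m+n; +-suc; n∸n≡0; +-∸-assoc; +-∸-comm; m+n∸n≡m; m≤n+m; +-comm;
         +-monoˡ-≤; +-monoʳ-≤; +-cancelˡ-≤; [m+n]∸[m+o]≡n∸o; +-commutativeSemigroup)
open import Algebra.Properties.CommutativeSemigroup +-commutativeSemigroup
  using (xy∙z≈xz∙y)
open import Data.Fin using (Fin; toℕ; punchIn) renaming (zero to fzero; suc to fsuc)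
open import Data.Product using (_×_; _,_)
open import Data.Empty using (⊥-elim)
open import Data.Sum using ([_,_]′)
open import Relation.Nullary using (¬_; yes; no)
open import Relation.Nullary.Decidable using (toSum)
import Relation.Binary.PropositionalEquality as ≡

[m+o]∸[n+o]≡m∸n : ∀ m n o → (m + o) ∸ (n + o) ≡.≡ m ∸ n
[m+o]∸[n+o]≡m∸n m n o =
  ≡.trans (≡.cong₂ _∸_ (+-comm m o) (+-comm n o)) ([m+n]∸[m+o]≡n∸o o m n)

module FieldProperties {c ℓ : Level} (K : Field c ℓ) where
  open Field K hiding (_+_)
  open FieldDefs K using (prod)
  open import Relation.Binary.Reasoning.Setoid setoid
  open import Algebra.Solver.CommutativeMonoid *-commutativeMonoid using (solve; _⊜_; _⊕_)

  inverseˡ : ∀ x → ¬ x ≈ 0# → x ⁻¹ * x ≈ 1#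
  inverseˡ x x≉0 = trans (*-comm _ _) (inverseʳ x x≉0)

  *-cancelʳ : ∀ {x y z} → ¬ z ≈ 0# → x * z ≈ y * z → x ≈ y
  *-cancelʳ {x} {y} {z} z≉0 xz≈yz = begin
    x                ≈⟨ sym (*-identityʳ x) ⟩
    x * 1#           ≈⟨ *-congˡ (sym (inverseʳ z z≉0)) ⟩
    x * (z * z ⁻¹)   ≈⟨ sym (*-assoc x z _) ⟩
    (x * z) * z ⁻¹   ≈⟨ *-congʳ xz≈yz ⟩
    (y * z) * z ⁻¹   ≈⟨ *-assoc y z _ ⟩
    y * (z * z ⁻¹)   ≈⟨ *-congˡ (inverseʳ z z≉0) ⟩
    y * 1#           ≈⟨ *-identityʳ y ⟩
    y                ∎

  *-nonzero : ∀ {x y} → ¬ x ≈ 0# → ¬ y ≈ 0# → ¬ x * y ≈ 0#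
  *-nonzero {x} {y} x≉0 y≉0 xy≈0 = y≉0 (begin
    y                ≈⟨ sym (*-identityˡ y) ⟩
    1# * y           ≈⟨ *-congʳ (sym (inverseˡ x x≉0)) ⟩
    (x ⁻¹ * x) * y   ≈⟨ *-assoc _ x y ⟩
    x ⁻¹ * (x * y)   ≈⟨ *-congˡ xy≈0 ⟩
    x ⁻¹ * 0#        ≈⟨ zeroʳ _ ⟩
    0#               ∎)

  rescaling-ratio : ∀ {x y x′ y′ D D′ h} → ¬ x ≈ 0# → ¬ y ≈ 0# →
    x * (y * D) ≈ x′ * (y′ * D′) → h * (x * y) ≈ x′ * y′ → D ≈ h * D′
  rescaling-ratio {x} {y} {x′} {y′} {D} {D′} {h} x≉0 y≉0 rescaled hxy≈x′y′ =
    *-cancelʳ (*-nonzero x≉0 y≉0) (begin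
      D * (x * y)           ≈⟨ solve 3 (λ D x y → D ⊕ (x ⊕ y) ⊜ x ⊕ (y ⊕ D)) refl D x y ⟩
      x * (y * D)           ≈⟨ rescaled ⟩
      x′ * (y′ * D′)        ≈⟨ sym (*-assoc x′ y′ D′) ⟩
      (x′ * y′) * D′        ≈⟨ *-congʳ (sym hxy≈x′y′) ⟩
      (h * (x * y)) * D′    ≈⟨ solve 3 (λ h xy D′ → (h ⊕ xy) ⊕ D′ ⊜ (h ⊕ D′) ⊕ xy) refl h (x * y) D′ ⟩
      (h * D′) * (x * y)    ∎)

  prod-cong : ∀ k {f g : ℕ → Carrier} → (∀ j → j < k → f j ≈ g j) → prod k f ≈ prod k g
  prod-cong zero    f≈g = refl
  prod-cong (suc k) f≈g = *-cong (prod-cong k (λ j j<k → f≈g j (m≤n⇒m≤1+n j<k))) (f≈g k ≤-refl)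

  prod-*-distrib : ∀ k (f g : ℕ → Carrier) → prod k (λ j → f j * g j) ≈ prod k f * prod k g
  prod-*-distrib zero    f g = sym (*-identityˡ 1#)
  prod-*-distrib (suc k) f g = begin
    prod k (λ j → f j * g j) * (f k * g k)  ≈⟨ *-congʳ (prod-*-distrib k f g) ⟩
    (prod k f * prod k g) * (f k * g k)     ≈⟨ solve 4 (λ F G x y → (F ⊕ G) ⊕ (x ⊕ y) ⊜ (F ⊕ x) ⊕ (G ⊕ y))
                                                 refl (prod k f) (prod k g) (f k) (g k) ⟩
    (prod k f * f k) * (prod k g * g k)     ∎

  prod-nonzero : ∀ k (f : ℕ → Carrier) → (∀ j → ¬ f j ≈ 0#) → ¬ prod k f ≈ 0#
  prod-nonzero zero    f f≉0 1≈0 = 0≉1 (sym 1≈0)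
  prod-nonzero (suc k) f f≉0     = *-nonzero (prod-nonzero k f f≉0) (f≉0 k)

  -- A sequence with T (p+1) = X (p+1) c T p behaves like a factorial with "factors" X:
  -- ∏_{j<k} X(m−j) / X(k−j) is then the "binomial coefficient" T m T 0 / (T (m−k) T k).
  module Telescoping (X T : ℕ → Carrier) (c : Carrier)
                     (step : ∀ p → (X (suc p) * c) * T p ≈ T (suc p)) where

    telescope : ∀ {k m} → k ≤ m → prod k (λ j → X (m ∸ j) * c) * T (m ∸ k) ≈ T m
    telescope {zero}          _         = *-identityˡ _
    telescope {suc k} {suc m} (s≤s k≤m) = begin
      (P * (X (suc m ∸ k) * c)) * T (m ∸ k)   ≈⟨ *-assoc P _ _ ⟩
      P * ((X (suc m ∸ k) * c) * T (m ∸ k))   ≡⟨ ≡.cong (λ i → P * ((X i * c) * T (m ∸ k))) 1+m∸k ⟩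
      P * ((X (suc (m ∸ k)) * c) * T (m ∸ k)) ≈⟨ *-congˡ (step (m ∸ k)) ⟩
      P * T (suc (m ∸ k))                     ≡⟨ ≡.cong (λ i → P * T i) (≡.sym 1+m∸k) ⟩
      P * T (suc m ∸ k)                       ≈⟨ telescope (m≤n⇒m≤1+n k≤m) ⟩
      T (suc m)                               ∎
      where
      P = prod k (λ j → X (suc m ∸ j) * c)
      1+m∸k : suc m ∸ k ≡.≡ suc (m ∸ k)
      1+m∸k = +-∸-assoc 1 k≤m

    prod-ratio : (∀ p → ¬ X (suc p) ≈ 0#) → ∀ {k m} → k ≤ m →
      prod k (λ j → X (m ∸ j) * X (k ∸ j) ⁻¹) * (T (m ∸ k) * T k) ≈ T m * T 0
    prod-ratio X≉0 {k} {m} k≤m = begin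
      A * (T (m ∸ k) * T k)            ≈⟨ *-congˡ (*-congˡ (sym (telescope ≤-refl))) ⟩
      A * (T (m ∸ k) * (Pₖ * T (k ∸ k))) ≡⟨ ≡.cong (λ i → A * (T (m ∸ k) * (Pₖ * T i))) (n∸n≡0 k) ⟩
      A * (T (m ∸ k) * (Pₖ * T 0))     ≈⟨ solve 4 (λ A T₁ P T₀ → A ⊕ (T₁ ⊕ (P ⊕ T₀)) ⊜ ((A ⊕ P) ⊕ T₁) ⊕ T₀)
                                            refl A (T (m ∸ k)) Pₖ (T 0) ⟩
      ((A * Pₖ) * T (m ∸ k)) * T 0     ≈⟨ *-congʳ (*-congʳ A*Pₖ≈Pₘ) ⟩
      (Pₘ * T (m ∸ k)) * T 0           ≈⟨ *-congʳ (telescope k≤m) ⟩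
      T m * T 0                        ∎
      where
      A  = prod k (λ j → X (m ∸ j) * X (k ∸ j) ⁻¹)
      Pₖ = prod k (λ j → X (k ∸ j) * c)
      Pₘ = prod k (λ j → X (m ∸ j) * c)

      X[k∸j]≉0 : ∀ {j} → j < k → ¬ X (k ∸ j) ≈ 0#
      X[k∸j]≉0 {j} j<k = ≡.subst (λ i → ¬ X i ≈ 0#) (≡.sym (+-∸-assoc 1 j<k)) (X≉0 (k ∸ suc j))

      cancel : ∀ {x y} → ¬ y ≈ 0# → (x * y ⁻¹) * (y * c) ≈ x * c
      cancel {x} {y} y≉0 = begin
        (x * y ⁻¹) * (y * c)  ≈⟨ solve 4 (λ x y′ y c → (x ⊕ y′) ⊕ (y ⊕ c) ⊜ (x ⊕ (y′ ⊕ y)) ⊕ c)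
                                   refl x (y ⁻¹) y c ⟩
        (x * (y ⁻¹ * y)) * c  ≈⟨ *-congʳ (*-congˡ (inverseˡ y y≉0)) ⟩
        (x * 1#) * c          ≈⟨ *-congʳ (*-identityʳ x) ⟩
        x * c                 ∎

      A*Pₖ≈Pₘ : A * Pₖ ≈ Pₘ
      A*Pₖ≈Pₘ = trans (sym (prod-*-distrib k _ _)) (prod-cong k (λ j j<k → cancel (X[k∸j]≉0 j<k)))

module DeterminantProperties {c ℓ : Level} (K : Field c ℓ) where
  open Field K hiding (_+_)
  open FieldDefs K using (sumFin; sign; det)
  open import Relation.Binary.Reasoning.Setoid setoid
  open import Algebra.Solver.CommutativeMonoid *-commutativeMonoid using (solve; _⊜_; _⊕_)
  open import Algebra.Properties.CommutativeMonoid.Sum *-commutativeMonoid public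
    using () renaming (sum to ∏; sum-remove to ∏-remove; sum-cong-≋ to ∏-cong)

  sumFin-cong : ∀ n {f g : Fin n → Carrier} → (∀ i → f i ≈ g i) → sumFin n f ≈ sumFin n g
  sumFin-cong zero    f≈g = refl
  sumFin-cong (suc n) f≈g = +-cong (f≈g fzero) (sumFin-cong n (λ i → f≈g (fsuc i)))

  sumFin-*-distribˡ : ∀ n x (f : Fin n → Carrier) → sumFin n (λ j → x * f j) ≈ x * sumFin n f
  sumFin-*-distribˡ zero    x f = sym (zeroʳ x)
  sumFin-*-distribˡ (suc n) x f =
    trans (+-congˡ (sumFin-*-distribˡ n x (λ j → f (fsuc j)))) (sym (distribˡ x _ _))

  det-cong : ∀ n {M N : Fin n → Fin n → Carrier} → (∀ i j → M i j ≈ N i j) → det n M ≈ det n N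
  det-cong zero    M≈N = refl
  det-cong (suc n) M≈N = sumFin-cong (suc n) (λ j →
    *-congˡ {sign (toℕ j)} (*-cong (M≈N fzero j) (det-cong n (λ i k → M≈N (fsuc i) (punchIn j k)))))

  -- In the cofactor of entry (0, j) the row scalings of rows 1.. and the column scalings of
  -- all columns but j occur; together with a 0 and b j they make up ∏ a and ∏ b.
  det-rescale : ∀ n (a b : Fin n → Carrier) (M : Fin n → Fin n → Carrier) →
    det n (λ i j → a i * (b j * M i j)) ≈ ∏ a * (∏ b * det n M)
  det-rescale zero    a b M = sym (trans (*-identityˡ _) (*-identityˡ _))
  det-rescale (suc n) a b M = begin
    sumFin (suc n) (λ j → sign (toℕ j) * ((a fzero * (b j * M fzero j)) * det n (minor′ j)))
      ≈⟨ sumFin-cong (suc n) term ⟩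
    sumFin (suc n) (λ j → (∏ a * ∏ b) * (sign (toℕ j) * (M fzero j * det n (minor j))))
      ≈⟨ sumFin-*-distribˡ (suc n) (∏ a * ∏ b) (λ j → sign (toℕ j) * (M fzero j * det n (minor j))) ⟩
    (∏ a * ∏ b) * det (suc n) M
      ≈⟨ *-assoc _ _ _ ⟩
    ∏ a * (∏ b * det (suc n) M) ∎
    where
    minor minor′ : Fin (suc n) → Fin n → Fin n → Carrier
    minor  j i k = M (fsuc i) (punchIn j k)
    minor′ j i k = a (fsuc i) * (b (punchIn j k) * minor j i k)

    term : ∀ j → sign (toℕ j) * ((a fzero * (b j * M fzero j)) * det n (minor′ j))
               ≈ (∏ a * ∏ b) * (sign (toℕ j) * (M fzero j * det n (minor j)))
    term j = begin
      σ * ((a₀ * (bⱼ * m)) * det n (minor′ j))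
        ≈⟨ *-congˡ (*-congˡ (det-rescale n (λ i → a (fsuc i)) (λ k → b (punchIn j k)) (minor j))) ⟩
      σ * ((a₀ * (bⱼ * m)) * (A * (B * D)))
        ≈⟨ solve 7 (λ σ a₀ bⱼ m A B D → σ ⊕ ((a₀ ⊕ (bⱼ ⊕ m)) ⊕ (A ⊕ (B ⊕ D)))
                                       ⊜ ((a₀ ⊕ A) ⊕ (bⱼ ⊕ B)) ⊕ (σ ⊕ (m ⊕ D)))
             refl σ a₀ bⱼ m A B D ⟩
      ((a₀ * A) * (bⱼ * B)) * (σ * (m * D))
        ≈⟨ *-congʳ (*-congˡ (sym (∏-remove b))) ⟩
      (∏ a * ∏ b) * (σ * (m * D)) ∎
      where
      σ  = sign (toℕ j)
      a₀ = a fzero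
      bⱼ = b j
      m  = M fzero j
      A  = ∏ (λ i → a (fsuc i))
      B  = ∏ (λ k → b (punchIn j k))
      D  = det n (minor j)

module FibonomialProperties {c ℓ : Level} (K : Field c ℓ) (s t : Field.Carrier K)
  (F≉0 : ∀ j → ¬ Field._≈_ K (FieldDefs.F K s t (suc j)) (Field.0# K)) where
  open Field K hiding (_+_; +-comm)
  open FieldDefs K
  open FieldProperties K
  open DeterminantProperties K
  open import Relation.Binary.Reasoning.Setoid setoid
  open import Algebra.Solver.CommutativeMonoid *-commutativeMonoid using (solve; _⊜_; _⊕_)

  [_]! : ℕ → Carrier
  [ m ]! = prod m (λ j → F s t (suc j))

  [_]!-nonzero : ∀ m → ¬ [ m ]! ≈ 0#
  [ m ]!-nonzero = prod-nonzero m _ F≉0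

  [1+p]! : ∀ p → (F s t (suc p) * 1#) * [ p ]! ≈ [ suc p ]!
  [1+p]! p = trans (*-congʳ (*-identityʳ _)) (*-comm _ _)

  fibonomial-fact : ∀ {k m} → k ≤ m → fibonomial s t m k * ([ m ∸ k ]! * [ k ]!) ≈ [ m ]!
  fibonomial-fact {k} {m} k≤m with k ≤? m
  ... | yes _   = trans (Telescoping.prod-ratio (F s t) [_]! 1# [1+p]! F≉0 k≤m) (*-identityʳ _)
  ... | no  k≰m = ⊥-elim (k≰m k≤m)

  fibonomial-outside : ∀ {k m} → ¬ k ≤ m → fibonomial s t m k ≈ 0#
  fibonomial-outside {k} {m} k≰m with k ≤? m
  ... | yes k≤m = ⊥-elim (k≰m k≤m)
  ... | no  _   = refl

  fibonomial-nonzero : ∀ {k m} → k ≤ m → ¬ fibonomial s t m k ≈ 0#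
  fibonomial-nonzero {k} {m} k≤m b≈0 = [ m ]!-nonzero (begin
    [ m ]!                                      ≈⟨ sym (fibonomial-fact k≤m) ⟩
    fibonomial s t m k * ([ m ∸ k ]! * [ k ]!)  ≈⟨ *-congʳ b≈0 ⟩
    0# * ([ m ∸ k ]! * [ k ]!)                  ≈⟨ zeroˡ _ ⟩
    0#                                          ∎)

  fact-fibonomial : ∀ {k m} → k ≤ m → [ m ∸ k ]! * ([ k ]! * fibonomial s t m k) ≈ [ m ]!
  fact-fibonomial {k} {m} k≤m = trans
    (solve 3 (λ x y b → x ⊕ (y ⊕ b) ⊜ b ⊕ (x ⊕ y)) refl [ m ∸ k ]! [ k ]! (fibonomial s t m k))
    (fibonomial-fact k≤m)

  -- Both sides equal [m + j]!.
  fibonomial-shift-lower : ∀ {k m} j → k ≤ m →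
    [ m ∸ k ]! * ([ k + j ]! * fibonomial s t (m + j) (k + j))
      ≈ [ m ]! * ([ j ]! * fibonomial s t (m + j) j)
  fibonomial-shift-lower {k} {m} j k≤m = begin
    [ m ∸ k ]! * ([ k + j ]! * fibonomial s t (m + j) (k + j))
      ≈⟨ *-congʳ (reflexive (≡.cong [_]! (≡.sym ([m+o]∸[n+o]≡m∸n m k j)))) ⟩
    [ (m + j) ∸ (k + j) ]! * ([ k + j ]! * fibonomial s t (m + j) (k + j))
      ≈⟨ fact-fibonomial (+-monoˡ-≤ j k≤m) ⟩
    [ m + j ]!
      ≈⟨ sym (fact-fibonomial (m≤n+m j m)) ⟩
    [ (m + j) ∸ j ]! * ([ j ]! * fibonomial s t (m + j) j)
      ≈⟨ *-congʳ (reflexive (≡.cong [_]! (m+n∸n≡m m j))) ⟩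
    [ m ]! * ([ j ]! * fibonomial s t (m + j) j) ∎

  -- Both sides equal [m]! [m + k]! / [m − j]!.
  fibonomial-shift-both-≤ : ∀ {m j} k → j ≤ m →
    [ m ]! * ([ k + j ]! * fibonomial s t (m + k) (k + j))
      ≈ [ m + k ]! * ([ j ]! * fibonomial s t m j)
  fibonomial-shift-both-≤ {m} {j} k j≤m = *-cancelʳ [ m ∸ j ]!-nonzero (begin
    ([ m ]! * ([ k + j ]! * B′)) * [ m ∸ j ]!
      ≈⟨ solve 4 (λ x y b z → (x ⊕ (y ⊕ b)) ⊕ z ⊜ x ⊕ (z ⊕ (y ⊕ b))) refl [ m ]! [ k + j ]! B′ [ m ∸ j ]! ⟩
    [ m ]! * ([ m ∸ j ]! * ([ k + j ]! * B′))
      ≈⟨ *-congˡ (*-congʳ (reflexive (≡.cong [_]! (≡.sym m+k∸[k+j]≡m∸j)))) ⟩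
    [ m ]! * ([ (m + k) ∸ (k + j) ]! * ([ k + j ]! * B′))
      ≈⟨ *-congˡ (fact-fibonomial k+j≤m+k) ⟩
    [ m ]! * [ m + k ]!
      ≈⟨ *-comm _ _ ⟩
    [ m + k ]! * [ m ]!
      ≈⟨ *-congˡ (sym (fact-fibonomial j≤m)) ⟩
    [ m + k ]! * ([ m ∸ j ]! * ([ j ]! * B))
      ≈⟨ solve 4 (λ x z y b → x ⊕ (z ⊕ (y ⊕ b)) ⊜ (x ⊕ (y ⊕ b)) ⊕ z) refl [ m + k ]! [ m ∸ j ]! [ j ]! B ⟩
    ([ m + k ]! * ([ j ]! * B)) * [ m ∸ j ]! ∎)
    where
    B  = fibonomial s t m j
    B′ = fibonomial s t (m + k) (k + j)
    m+k∸[k+j]≡m∸j : (m + k) ∸ (k + j) ≡.≡ m ∸ j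
    m+k∸[k+j]≡m∸j = ≡.trans (≡.cong (_∸ (k + j)) (+-comm m k)) ([m+n]∸[m+o]≡n∸o k m j)
    k+j≤m+k : k + j ≤ m + k
    k+j≤m+k = ≡.subst (k + j ≤_) (+-comm k m) (+-monoʳ-≤ k j≤m)

  fibonomial-shift-both-≰ : ∀ {m j} k → ¬ j ≤ m →
    [ m ]! * ([ k + j ]! * fibonomial s t (m + k) (k + j))
      ≈ [ m + k ]! * ([ j ]! * fibonomial s t m j)
  fibonomial-shift-both-≰ {m} {j} k j≰m = begin
    [ m ]! * ([ k + j ]! * fibonomial s t (m + k) (k + j)) ≈⟨ *-congˡ (*-congˡ (fibonomial-outside k+j≰m+k)) ⟩
    [ m ]! * ([ k + j ]! * 0#)                              ≈⟨ *-congˡ (zeroʳ _) ⟩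
    [ m ]! * 0#                                             ≈⟨ zeroʳ _ ⟩
    0#                                                      ≈⟨ sym (zeroʳ _) ⟩
    [ m + k ]! * 0#                                         ≈⟨ *-congˡ (sym (zeroʳ _)) ⟩
    [ m + k ]! * ([ j ]! * 0#)                              ≈⟨ *-congˡ (*-congˡ (sym (fibonomial-outside j≰m))) ⟩
    [ m + k ]! * ([ j ]! * fibonomial s t m j)              ∎
    where
    k+j≰m+k : ¬ k + j ≤ m + k
    k+j≰m+k k+j≤m+k = j≰m (+-cancelˡ-≤ k j m (≡.subst (k + j ≤_) (+-comm m k) k+j≤m+k))

  fibonomial-shift-both : ∀ m k j →
    [ m ]! * ([ k + j ]! * fibonomial s t (m + k) (k + j))
      ≈ [ m + k ]! * ([ j ]! * fibonomial s t m j)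
  fibonomial-shift-both m k j =
    [ fibonomial-shift-both-≤ k , fibonomial-shift-both-≰ k ]′ (toSum (j ≤? m))

  Φ : ℕ → ℕ → Carrier
  Φ zero    m = 1#
  Φ (suc d) m = [ m ]! * Φ d (suc m)

  Φ-nonzero : ∀ d m → ¬ Φ d m ≈ 0#
  Φ-nonzero zero    m 1≈0 = 0≉1 (sym 1≈0)
  Φ-nonzero (suc d) m     = *-nonzero [ m ]!-nonzero (Φ-nonzero d (suc m))

  ∏≈Φ : ∀ d m → ∏ (λ (i : Fin d) → [ m + toℕ i ]!) ≈ Φ d m
  ∏≈Φ zero    m = refl
  ∏≈Φ (suc d) m = *-cong
    (reflexive (≡.cong [_]! (+-comm m 0)))
    (trans (∏-cong {d} (λ i → reflexive (≡.cong [_]! (+-suc m (toℕ i))))) (∏≈Φ d (suc m)))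

  Φ-suc : ∀ d m → Φ d (suc m) * [ m ]! ≈ Φ d m * [ m + d ]!
  Φ-suc zero    m = *-congˡ (reflexive (≡.cong [_]! (≡.sym (+-comm m 0))))
  Φ-suc (suc d) m = begin
    ([ suc m ]! * Φ d (suc (suc m))) * [ m ]!
      ≈⟨ solve 3 (λ x R y → (x ⊕ R) ⊕ y ⊜ y ⊕ (R ⊕ x)) refl [ suc m ]! (Φ d (suc (suc m))) [ m ]! ⟩
    [ m ]! * (Φ d (suc (suc m)) * [ suc m ]!)
      ≈⟨ *-congˡ (Φ-suc d (suc m)) ⟩
    [ m ]! * (Φ d (suc m) * [ suc m + d ]!)
      ≈⟨ sym (*-assoc _ _ _) ⟩
    ([ m ]! * Φ d (suc m)) * [ suc m + d ]!
      ≈⟨ *-congˡ (reflexive (≡.cong [_]! (≡.sym (+-suc m d)))) ⟩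
    ([ m ]! * Φ d (suc m)) * [ m + suc d ]! ∎

  -- hoggatt s t d n k unfolds to ∏_{j<k} hoggattFactor d (n ∸ j) / hoggattFactor d (k ∸ j).
  hoggattFactor : ℕ → ℕ → Carrier
  hoggattFactor d m = fibonomial s t ((m + d) ∸ 1) d

  hoggattFactor-step : ∀ d p → (hoggattFactor d (suc p) * [ d ]!) * Φ d p ≈ Φ d (suc p)
  hoggattFactor-step d p = *-cancelʳ [ p ]!-nonzero (begin
    ((Y * [ d ]!) * Φ d p) * [ p ]!
      ≈⟨ solve 4 (λ Y x R y → ((Y ⊕ x) ⊕ R) ⊕ y ⊜ (Y ⊕ (y ⊕ x)) ⊕ R) refl Y [ d ]! (Φ d p) [ p ]! ⟩
    (Y * ([ p ]! * [ d ]!)) * Φ d p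
      ≡⟨ ≡.cong (λ i → (Y * ([ i ]! * [ d ]!)) * Φ d p) (≡.sym (m+n∸n≡m p d)) ⟩
    (Y * ([ (p + d) ∸ d ]! * [ d ]!)) * Φ d p
      ≈⟨ *-congʳ (fibonomial-fact (m≤n+m d p)) ⟩
    [ p + d ]! * Φ d p
      ≈⟨ *-comm _ _ ⟩
    Φ d p * [ p + d ]!
      ≈⟨ sym (Φ-suc d p) ⟩
    Φ d (suc p) * [ p ]! ∎)
    where
    Y = hoggattFactor d (suc p)

  hoggatt-Φ : ∀ d {n k} → k ≤ n →
    hoggatt s t d n k * (Φ d (n ∸ k) * Φ d k) ≈ Φ d n * Φ d 0
  hoggatt-Φ d = Telescoping.prod-ratio (hoggattFactor d) (Φ d) [ d ]!
    (hoggattFactor-step d) (λ p → fibonomial-nonzero (m≤n+m d p))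

  det-rescale-Φ : ∀ d {m r m′ r′} {M M′ : Fin d → Fin d → Carrier} →
    (∀ i j → [ m + toℕ i ]! * ([ r + toℕ j ]! * M i j)
           ≈ [ m′ + toℕ i ]! * ([ r′ + toℕ j ]! * M′ i j)) →
    Φ d m * (Φ d r * det d M) ≈ Φ d m′ * (Φ d r′ * det d M′)
  det-rescale-Φ d {m} {r} {m′} {r′} {M} {M′} rescaled = begin
    Φ d m * (Φ d r * det d M)
      ≈⟨ sym (*-cong (∏≈Φ d m) (*-congʳ (∏≈Φ d r))) ⟩
    ∏ {d} (λ i → [ m + toℕ i ]!) * (∏ {d} (λ j → [ r + toℕ j ]!) * det d M)
      ≈⟨ sym (det-rescale d (λ i → [ m + toℕ i ]!) (λ j → [ r + toℕ j ]!) M) ⟩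
    det d (λ i j → [ m + toℕ i ]! * ([ r + toℕ j ]! * M i j))
      ≈⟨ det-cong d rescaled ⟩
    det d (λ i j → [ m′ + toℕ i ]! * ([ r′ + toℕ j ]! * M′ i j))
      ≈⟨ det-rescale d (λ i → [ m′ + toℕ i ]!) (λ j → [ r′ + toℕ j ]!) M′ ⟩
    ∏ {d} (λ i → [ m′ + toℕ i ]!) * (∏ {d} (λ j → [ r′ + toℕ j ]!) * det d M′)
      ≈⟨ *-cong (∏≈Φ d m′) (*-congʳ (∏≈Φ d r′)) ⟩
    Φ d m′ * (Φ d r′ * det d M′) ∎

  det-fibonomial-shift-lower : ∀ d n k → k ≤ n →
    det d (λ i j → fibonomial s t (n + toℕ i + toℕ j) (k + toℕ j))
      ≈ hoggatt s t d n k * det d (λ i j → fibonomial s t (n + toℕ i + toℕ j) (toℕ j))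
  det-fibonomial-shift-lower d n k k≤n =
    rescaling-ratio (Φ-nonzero d (n ∸ k)) (Φ-nonzero d k)
      (det-rescale-Φ d rescaled) (hoggatt-Φ d k≤n)
    where
    rescaled : ∀ (i j : Fin d) →
      [ (n ∸ k) + toℕ i ]! * ([ k + toℕ j ]! * fibonomial s t (n + toℕ i + toℕ j) (k + toℕ j))
        ≈ [ n + toℕ i ]! * ([ toℕ j ]! * fibonomial s t (n + toℕ i + toℕ j) (toℕ j))
    rescaled i j = trans
      (*-congʳ (reflexive (≡.cong [_]! (≡.sym (+-∸-comm (toℕ i) k≤n)))))
      (fibonomial-shift-lower (toℕ j) (≤-trans k≤n (m≤m+n n (toℕ i))))

  det-fibonomial-shift-both : ∀ d n k →
    det d (λ i j → fibonomial s t (n + toℕ i + k) (k + toℕ j))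
      ≈ hoggatt s t d (n + k) k * det d (λ i j → fibonomial s t (n + toℕ i) (toℕ j))
  det-fibonomial-shift-both d n k =
    rescaling-ratio (Φ-nonzero d n) (Φ-nonzero d k)
      (det-rescale-Φ d rescaled) hoggatt≈
    where
    rescaled : ∀ (i j : Fin d) →
      [ n + toℕ i ]! * ([ k + toℕ j ]! * fibonomial s t (n + toℕ i + k) (k + toℕ j))
        ≈ [ (n + k) + toℕ i ]! * ([ toℕ j ]! * fibonomial s t (n + toℕ i) (toℕ j))
    rescaled i j = trans (fibonomial-shift-both (n + toℕ i) k (toℕ j))
      (*-congʳ (reflexive (≡.cong [_]! (xy∙z≈xz∙y n (toℕ i) k))))

    hoggatt≈ : hoggatt s t d (n + k) k * (Φ d n * Φ d k) ≈ Φ d (n + k) * Φ d 0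
    hoggatt≈ = ≡.subst (λ x → hoggatt s t d (n + k) k * (Φ d x * Φ d k) ≈ Φ d (n + k) * Φ d 0)
      (m+n∸n≡m n k) (hoggatt-Φ d (m≤n+m k n))

theorem17 : ∀ {c ℓ : Level} (K : Field c ℓ) (s t : Field.Carrier K) →
    (∀ j → ¬ (Field._≈_ K (FieldDefs.F K s t (suc j)) (Field.0# K))) →
    (d : ℕ) → 1 ≤ d →
      (∀ n k → k ≤ n →
        Field._≈_ K
          (FieldDefs.det K d (λ i j → FieldDefs.fibonomial K s t (n + toℕ i + toℕ j) (k + toℕ j)))
          (Field._*_ K (FieldDefs.hoggatt K s t d n k)
            (FieldDefs.det K d (λ i j → FieldDefs.fibonomial K s t (n + toℕ i + toℕ j) (toℕ j)))))
      ×
      (∀ n k →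
        Field._≈_ K
          (FieldDefs.det K d (λ i j → FieldDefs.fibonomial K s t (n + toℕ i + k) (k + toℕ j)))
          (Field._*_ K (FieldDefs.hoggatt K s t d (n + k) k)
            (FieldDefs.det K d (λ i j → FieldDefs.fibonomial K s t (n + toℕ i) (toℕ j)))))
theorem17 K s t F≉0 d _ = det-fibonomial-shift-lower d , det-fibonomial-shift-both d
  where open FibonomialProperties K s t F≉0
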